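{- Let $f:2^X\to\mathbb{R}_{\ge0}$ be a monotone nonincreasing function with curvature at most $c\in[0,1]$, and let $\mathcal{M}$ be a matroid on $X$ with dual matroid $\mathcal{M}^*$. Let $f^*(A)=f(X\setminus A)$, let $S^*$ be the base of $\mathcal{M}^*$ produced by running the standard greedy minimization algorithm on $f^*$ and $\mathcal{M}^*$, and let $S=X\setminus S^*$ (a base of $\mathcal{M}$). Then for any base $O$ of $\mathcal{M}$, with $O^*=X\setminus O$, $$f(S)=f^*(S^*)\le\frac{1}{1-c}f^*(O^*)=\frac{1}{1-c}f(O).$$
   Context: $f_A(j)=f(A\cup\{j\})-f(A)$. Curvature of a monotone function: $c=1-\min_{j\in X}\min_{S,T\subseteq X\setminus\{j\}}\frac{f_S(j)}{f_T(j)}$; for nonincreasing $f$, curvature at most $c$ means $(1-c)f_B(j)\ge f_A(j)$ for all $j$ and $A,B\subseteq X\setminus\{j\}$. The dual matroid $\mathcal{M}^*$ has as bases exactly the complements of bases of $\mathcal{M}$. The standard greedy minimization algorithm starts from $\emptyset$ and repeatedly adds an element $e$ keeping the set independent and minimizing the marginal gain $f^*_S(e)$, terminating only when no element can be added.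
   Formalization: The function f takes nonnegative rational values and the curvature bound c is rational, instead of real. -}

module Defs where

open import Level using (0ℓ)
open import Data.Nat using (ℕ; _<_)
open import Data.Fin using (Fin)
open import Data.Fin.Subset using (Subset; _∪_; ∁; ⁅_⁆; _∈_; _∉_; _⊆_; ∣_∣; ⊥)
open import Data.Product using (Σ; ∃; _×_; _,_)
open import Data.Rational using (ℚ; 0ℚ; 1ℚ; _-_; _+_; -_; _*_; _≤_; 1/_; NonZero; >-nonZero)
  renaming (_<_ to _<ℚ_)
open import Data.Rational.Properties using (+-monoˡ-<; +-inverseʳ)
open import Relation.Nullary using (¬_)
open import Relation.Binary.PropositionalEquality using (subst)

-- Ground set X = Fin n; subsets of X are 'Subset n' (characteristic vectors).

record Matroid (n : ℕ) : Set₁ where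
  field
    Indep        : Subset n → Set
    indep-empty  : Indep ⊥
    indep-subset : ∀ {A B} → A ⊆ B → Indep B → Indep A
    indep-augment : ∀ {A B} → Indep A → Indep B → ∣ A ∣ < ∣ B ∣ →
                    ∃ λ e → e ∈ B × e ∉ A × Indep (A ∪ ⁅ e ⁆)

IsBase : ∀ {n} → Matroid n → Subset n → Set
IsBase M B = Matroid.Indep M B × (∀ e → e ∉ B → ¬ Matroid.Indep M (B ∪ ⁅ e ⁆))

-- Independent sets of the dual matroid M*: subsets of complements of bases of M
-- (so the bases of M* are exactly the complements of bases of M).
DualIndep : ∀ {n} → Matroid n → Subset n → Set
DualIndep M I = ∃ λ B → IsBase M B × I ⊆ ∁ B

marg : ∀ {n} → (Subset n → ℚ) → Subset n → Fin n → ℚ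
marg f A j = f (A ∪ ⁅ j ⁆) - f A

Nonincreasing : ∀ {n} → (Subset n → ℚ) → Set
Nonincreasing f = ∀ {A B} → A ⊆ B → f B ≤ f A

CurvatureAtMost : ∀ {n} → ℚ → (Subset n → ℚ) → Set
CurvatureAtMost c f = ∀ j A B → j ∉ A → j ∉ B → marg f A j ≤ (1ℚ - c) * marg f B j

dualFn : ∀ {n} → (Subset n → ℚ) → Subset n → ℚ
dualFn f A = f (∁ A)

-- GreedyRun Ind g S T : the standard greedy minimization algorithm, for the
-- independence predicate Ind and function g, when its current set is S,
-- can terminate with output T.
data GreedyRun {n : ℕ} (Ind : Subset n → Set) (g : Subset n → ℚ) :
               Subset n → Subset n → Set where
  stop : ∀ {S} → (∀ e → e ∉ S → ¬ Ind (S ∪ ⁅ e ⁆)) → GreedyRun Ind g S S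
  step : ∀ {S T} e → e ∉ S → Ind (S ∪ ⁅ e ⁆) →
         (∀ e′ → e′ ∉ S → Ind (S ∪ ⁅ e′ ⁆) → marg g S e ≤ marg g S e′) →
         GreedyRun Ind g (S ∪ ⁅ e ⁆) T → GreedyRun Ind g S T

GreedyOutput : ∀ {n} → (Subset n → Set) → (Subset n → ℚ) → Subset n → Set
GreedyOutput Ind g T = GreedyRun Ind g ⊥ T

1-c-pos : ∀ {c} → c <ℚ 1ℚ → 0ℚ <ℚ 1ℚ - c
1-c-pos {c} c<1 = subst (_<ℚ 1ℚ - c) (+-inverseʳ c) (+-monoˡ-< (- c) c<1)

inv1-c : (c : ℚ) → c <ℚ 1ℚ → ℚ
inv1-c c c<1 = (1/ (1ℚ - c)) {{>-nonZero (1-c-pos c<1)}}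

{-# OPTIONS --safe #-}
-- Write g = f*, i.e. g(A) = f(X ∖ A): it is nondecreasing, and curvature at most c for f becomes
-- (1 - c) g_T(j) ≤ g_S(j) for g.  Along the greedy run ∅ = S₀ ⊂ S₁ ⊂ ⋯ ⊂ S* keep a set P, initially
-- O*, such that S ∪ P contains the complement of a base disjoint from S.  When greedy adds e, base
-- exchange yields o ∈ P that greedy could have added instead, and S ∪ {e} ∪ (P ∖ o) again satisfies
-- the invariant; the greedy choice and the curvature bound give
--   (1 - c) g_S(e) ≤ (1 - c) g_S(o) ≤ g_{P∖o}(o) = g(P) - g(P ∖ o),
-- so by induction (1 - c)(g(S*) - g(∅)) ≤ g(O*) - g(∅).  Since g(∅) = f(X) ≥ 0 and c ≥ 0,
-- (1 - c) g(S*) ≤ g(O*).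

module Submission where

open import Defs
open import Data.Bool.Base using (not)
open import Data.Bool.Properties using (∨-identityʳ)
open import Data.Nat using (ℕ; suc)
import Data.Nat as ℕ
import Data.Nat.Properties as ℕ
open import Data.Fin using (Fin; zero; suc)
import Data.Fin.Properties as Fin
open import Data.Fin.Subset renaming (_-_ to _∖_)
open import Data.Fin.Subset.Properties
open import Data.Vec using (_∷_; here; there)
open import Data.Product using (∃; _×_; _,_)
open import Data.Sum using (_⊎_; inj₁; inj₂)
open import Data.Rational using (ℚ; 0ℚ; 1ℚ; _+_; _-_; -_; _*_; 1/_; _≤_; _<_; >-nonZero; positive; nonNegative)
open import Data.Rational.Properties
  using (+-inverseʳ; +-identityʳ; +-mono-≤; +-monoˡ-≤; +-monoʳ-≤; neg-antimono-≤;
         *-identityˡ; *-inverseʳ; *-assoc; *-monoˡ-≤-nonNeg; *-monoʳ-≤-nonNeg; *-cancelˡ-≤-pos;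
         module ≤-Reasoning)
open import Data.Rational.Solver
open import Function.Base using (_∘_; case_of_)
open import Relation.Nullary using (yes; no; contradiction)
open import Relation.Binary.PropositionalEquality
import Algebra.Lattice.Properties.BooleanAlgebra as BooleanAlgebraProperties

open +-*-Solver

private variable
  n : ℕ
  p q : Subset n
  x y : Fin n

∁-involutive : (p : Subset n) → ∁ (∁ p) ≡ p
∁-involutive {n} = BooleanAlgebraProperties.¬-involutive (∪-∩-booleanAlgebra n)

x∉p∖x : x ∉ p ∖ x
x∉p∖x {x = zero}  {p = _ ∷ _} ()
x∉p∖x {x = suc x} {p = _ ∷ _} (there x∈p∖x) = x∉p∖x x∈p∖x

x∈p∪⁅x⁆ : x ∈ p ∪ ⁅ x ⁆
x∈p∪⁅x⁆ {x = x} {p = p} = q⊆p∪q p ⁅ x ⁆ (x∈⁅x⁆ x)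

x∈p∪⁅y⁆⁻ : x ∈ p ∪ ⁅ y ⁆ → x ∈ p ⊎ x ≡ y
x∈p∪⁅y⁆⁻ {p = p} {y} x∈ with x∈p∪q⁻ p ⁅ y ⁆ x∈
... | inj₁ x∈p = inj₁ x∈p
... | inj₂ x∈⁅y⁆ = inj₂ (x∈⁅y⁆⇒x≡y y x∈⁅y⁆)

p⊆q∧y∈q⇒p∪⁅y⁆⊆q : p ⊆ q → y ∈ q → p ∪ ⁅ y ⁆ ⊆ q
p⊆q∧y∈q⇒p∪⁅y⁆⊆q p⊆q y∈q x∈ with x∈p∪⁅y⁆⁻ x∈
... | inj₁ x∈p = p⊆q x∈p
... | inj₂ refl = y∈q

∣p∪⁅x⁆∣≡1+∣p∣ : x ∉ p → ∣ p ∪ ⁅ x ⁆ ∣ ≡ suc ∣ p ∣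
∣p∪⁅x⁆∣≡1+∣p∣ {x = zero}  {p = inside  ∷ p} x∉p = contradiction here x∉p
∣p∪⁅x⁆∣≡1+∣p∣ {x = zero}  {p = outside ∷ p} _   = cong (suc ∘ ∣_∣) (∪-identityʳ p)
∣p∪⁅x⁆∣≡1+∣p∣ {x = suc x} {p = inside  ∷ p} x∉p = cong suc (∣p∪⁅x⁆∣≡1+∣p∣ (x∉p ∘ there))
∣p∪⁅x⁆∣≡1+∣p∣ {x = suc x} {p = outside ∷ p} x∉p = ∣p∪⁅x⁆∣≡1+∣p∣ (x∉p ∘ there)

p∖x∪⁅x⁆≡p : x ∈ p → (p ∖ x) ∪ ⁅ x ⁆ ≡ p
p∖x∪⁅x⁆≡p {x = zero}  {p = inside ∷ p} here = cong (inside ∷_) (trans (∪-identityʳ (p ─ ⊥)) (p─⊥≡p p))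
p∖x∪⁅x⁆≡p {x = suc x} {p = s ∷ p} (there x∈p) = cong₂ _∷_ (∨-identityʳ s) (p∖x∪⁅x⁆≡p x∈p)

∁[p∪⁅x⁆]∪⁅x⁆≡∁p : x ∉ p → ∁ (p ∪ ⁅ x ⁆) ∪ ⁅ x ⁆ ≡ ∁ p
∁[p∪⁅x⁆]∪⁅x⁆≡∁p {x = zero}  {p = inside  ∷ p} x∉p = contradiction here x∉p
∁[p∪⁅x⁆]∪⁅x⁆≡∁p {x = zero}  {p = outside ∷ p} _   =
  cong (inside ∷_) (trans (∪-identityʳ (∁ (p ∪ ⊥))) (cong ∁ (∪-identityʳ p)))
∁[p∪⁅x⁆]∪⁅x⁆≡∁p {x = suc x} {p = s ∷ p} x∉p =
  cong₂ _∷_ (trans (∨-identityʳ _) (cong not (∨-identityʳ s))) (∁[p∪⁅x⁆]∪⁅x⁆≡∁p (x∉p ∘ there))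

∣p∣≡1+∣p∖x∣ : x ∈ p → ∣ p ∣ ≡ suc ∣ p ∖ x ∣
∣p∣≡1+∣p∖x∣ {x = x} {p = p} x∈p =
  trans (cong ∣_∣ (sym (p∖x∪⁅x⁆≡p x∈p))) (∣p∪⁅x⁆∣≡1+∣p∣ (x∉p∖x {x = x} {p = p}))

x∈p∪q∧x∉p⇒x∈q : x ∈ p ∪ q → x ∉ p → x ∈ q
x∈p∪q∧x∉p⇒x∈q {p = p} {q} x∈p∪q x∉p with x∈p∪q⁻ p q x∈p∪q
... | inj₁ x∈p = contradiction x∈p x∉p
... | inj₂ x∈q = x∈q

p∪q⊆[p∪⁅x⁆]∪[q∖x] : p ∪ q ⊆ (p ∪ ⁅ x ⁆) ∪ (q ∖ x)
p∪q⊆[p∪⁅x⁆]∪[q∖x] {p = p} {q} {x} {y} y∈p∪q with x∈p∪q⁻ p q y∈p∪q | y Fin.≟ x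
... | inj₁ y∈p | _        = p⊆p∪q _ (p⊆p∪q _ y∈p)
... | inj₂ _   | yes refl = p⊆p∪q _ x∈p∪⁅x⁆
... | inj₂ y∈q | no y≢x   = q⊆p∪q _ _ (x∈p∧x≢y⇒x∈p-y y∈q y≢x)

p⊆∁q∧x∉p⇒p⊆∁[q∪⁅x⁆] : p ⊆ ∁ q → x ∉ p → p ⊆ ∁ (q ∪ ⁅ x ⁆)
p⊆∁q∧x∉p⇒p⊆∁[q∪⁅x⁆] p⊆∁q x∉p {y} y∈p = x∉p⇒x∈∁p λ y∈q∪⁅x⁆ → case x∈p∪⁅y⁆⁻ y∈q∪⁅x⁆ of λ where
  (inj₁ y∈q) → x∈∁p⇒x∉p (p⊆∁q y∈p) y∈q
  (inj₂ refl) → x∉p y∈p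

p≤q⇒0≤q-p : ∀ {p q} → p ≤ q → 0ℚ ≤ q - p
p≤q⇒0≤q-p {p} {q} p≤q = subst (_≤ q - p) (+-inverseʳ p) (+-monoˡ-≤ (- p) p≤q)

0≤p⇒q-p≤q : ∀ {p q} → 0ℚ ≤ p → q - p ≤ q
0≤p⇒q-p≤q {p} {q} 0≤p = subst (q - p ≤_) (+-identityʳ q) (+-monoʳ-≤ q (neg-antimono-≤ 0≤p))

p*[q-r]≤s-r⇒p*q≤s : ∀ {p q r s} → p ≤ 1ℚ → 0ℚ ≤ r → p * (q - r) ≤ s - r → p * q ≤ s
p*[q-r]≤s-r⇒p*q≤s {p} {q} {r} {s} p≤1 0≤r h = begin
  p * q               ≡⟨ solve 3 (λ p q r → p :* q := p :* (q :- r) :+ p :* r) refl p q r ⟩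
  p * (q - r) + p * r ≤⟨ +-mono-≤ h (*-monoʳ-≤-nonNeg r {{nonNegative 0≤r}} p≤1) ⟩
  (s - r) + 1ℚ * r    ≡⟨ solve 2 (λ r s → (s :- r) :+ con 1ℚ :* r := s) refl r s ⟩
  s                   ∎
  where open ≤-Reasoning

p*q≤r⇒q≤1/p*r : ∀ {p q r} → (0<p : 0ℚ < p) → p * q ≤ r → q ≤ (1/ p) {{>-nonZero 0<p}} * r
p*q≤r⇒q≤1/p*r {p} {q} {r} 0<p pq≤r = *-cancelˡ-≤-pos p {{positive 0<p}} (begin
  p * q             ≤⟨ pq≤r ⟩
  r                 ≡⟨ *-identityˡ r ⟨
  1ℚ * r            ≡⟨ cong (_* r) (*-inverseʳ p) ⟨
  (p * p⁻¹) * r     ≡⟨ *-assoc p p⁻¹ r ⟩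
  p * (p⁻¹ * r)     ∎)
  where
  open ≤-Reasoning
  instance _ = >-nonZero 0<p
  p⁻¹ = 1/ p

module _ {n : ℕ} (M : Matroid n) where
  open Matroid M

  private variable
    B B′ I S P : Subset n
    e : Fin n

  base-maximum-size : IsBase M B → Indep I → ∣ I ∣ ℕ.≤ ∣ B ∣
  base-maximum-size (indB , maxB) indI = ℕ.≮⇒≥ λ ∣B∣<∣I∣ →
    let e , _ , e∉B , indB∪e = indep-augment indB indI ∣B∣<∣I∣ in maxB e e∉B indB∪e

  indep-of-base-size⇒base : IsBase M B → Indep I → ∣ B ∣ ℕ.≤ ∣ I ∣ → IsBase M I
  indep-of-base-size⇒base baseB indI ∣B∣≤∣I∣ = indI , λ e e∉I indI∪e →
    ℕ.≤⇒≯ ∣B∣≤∣I∣ (subst (ℕ._≤ _) (∣p∪⁅x⁆∣≡1+∣p∣ e∉I) (base-maximum-size baseB indI∪e))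

  base-exchange : IsBase M B → IsBase M B′ → e ∈ B →
    ∃ λ x → x ∈ B′ × x ∉ B ∖ e × IsBase M ((B ∖ e) ∪ ⁅ x ⁆)
  base-exchange {B} {B′} {e} baseB@(indB , _) baseB′@(indB′ , _) e∈B
    with indep-augment (indep-subset (p─q⊆p B ⁅ e ⁆) indB) indB′
           (subst (ℕ._≤ ∣ B′ ∣) (∣p∣≡1+∣p∖x∣ e∈B) (base-maximum-size baseB′ indB))
  ... | x , x∈B′ , x∉B∖e , indB∖e∪x = x , x∈B′ , x∉B∖e ,
    indep-of-base-size⇒base baseB indB∖e∪x
      (ℕ.≤-reflexive (trans (∣p∣≡1+∣p∖x∣ e∈B) (sym (∣p∪⁅x⁆∣≡1+∣p∣ x∉B∖e))))

  CobaseBetween : Subset n → Subset n → Set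
  CobaseBetween S U = ∃ λ B → IsBase M B × S ⊆ ∁ B × ∁ B ⊆ U

  cobase-exchange-∈ : IsBase M B → S ⊆ ∁ B → ∁ B ⊆ S ∪ P → e ∈ B → DualIndep M (S ∪ ⁅ e ⁆) →
    ∃ λ o → o ∈ P × o ∉ S × DualIndep M (S ∪ ⁅ o ⁆)
      × CobaseBetween (S ∪ ⁅ e ⁆) ((S ∪ ⁅ e ⁆) ∪ (P ∖ o))
  cobase-exchange-∈ {B} {S} {P} {e} baseB S⊆∁B ∁B⊆S∪P e∈B (B′ , baseB′ , S∪e⊆∁B′)
    with base-exchange baseB baseB′ e∈B
  ... | x , x∈B′ , x∉B∖e , baseB″ =
    x , x∈P , x∉S , (B , baseB , p⊆q∧y∈q⇒p∪⁅y⁆⊆q S⊆∁B (x∉p⇒x∈∁p x∉B)) ,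
    (B ∖ e) ∪ ⁅ x ⁆ , baseB″ , p⊆∁q∧x∉p⇒p⊆∁[q∪⁅x⁆] S∪e⊆∁[B∖e] x∉S∪e , ∁B″⊆S∪e∪[P∖x]
    where
    x∉S∪e : x ∉ S ∪ ⁅ e ⁆
    x∉S∪e x∈S∪e = x∈∁p⇒x∉p (S∪e⊆∁B′ x∈S∪e) x∈B′
    x∉S : x ∉ S
    x∉S = x∉S∪e ∘ p⊆p∪q _
    x∉B : x ∉ B
    x∉B x∈B = x∉B∖e (x∈p∧x≢y⇒x∈p-y x∈B λ { refl → x∉S∪e x∈p∪⁅x⁆ })
    x∈P : x ∈ P
    x∈P = x∈p∪q∧x∉p⇒x∈q (∁B⊆S∪P (x∉p⇒x∈∁p x∉B)) x∉S
    S∪e⊆∁[B∖e] : S ∪ ⁅ e ⁆ ⊆ ∁ (B ∖ e)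
    S∪e⊆∁[B∖e] = p⊆q∧y∈q⇒p∪⁅y⁆⊆q (⊆-trans S⊆∁B (p⊆q⇒∁p⊇∁q (p─q⊆p B _))) (x∉p⇒x∈∁p (x∉p∖x {p = B}))
    ∁B″⊆S∪e∪[P∖x] : ∁ ((B ∖ e) ∪ ⁅ x ⁆) ⊆ (S ∪ ⁅ e ⁆) ∪ (P ∖ x)
    ∁B″⊆S∪e∪[P∖x] {y} y∈∁B″ with y Fin.≟ e | y Fin.≟ x
    ... | yes refl | _        = p⊆p∪q _ x∈p∪⁅x⁆
    ... | no _     | yes refl = contradiction x∈p∪⁅x⁆ (x∈∁p⇒x∉p y∈∁B″)
    ... | no y≢e   | no y≢x   with x∈p∪q⁻ S P (∁B⊆S∪P (x∉p⇒x∈∁p y∉B))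
      where
      y∉B : y ∉ B
      y∉B y∈B = x∈∁p⇒x∉p y∈∁B″ (p⊆p∪q _ (x∈p∧x≢y⇒x∈p-y y∈B y≢e))
    ... | inj₁ y∈S = p⊆p∪q _ (p⊆p∪q _ y∈S)
    ... | inj₂ y∈P = q⊆p∪q _ _ (x∈p∧x≢y⇒x∈p-y y∈P y≢x)

  cobase-exchange : CobaseBetween S (S ∪ P) → e ∉ S → DualIndep M (S ∪ ⁅ e ⁆) →
    ∃ λ o → o ∈ P × o ∉ S × DualIndep M (S ∪ ⁅ o ⁆)
      × CobaseBetween (S ∪ ⁅ e ⁆) ((S ∪ ⁅ e ⁆) ∪ (P ∖ o))
  cobase-exchange {e = e} (B , baseB , S⊆∁B , ∁B⊆S∪P) e∉S indS∪e with e ∈? B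
  ... | no e∉B =
    e , x∈p∪q∧x∉p⇒x∈q (∁B⊆S∪P (x∉p⇒x∈∁p e∉B)) e∉S , e∉S , indS∪e ,
    B , baseB , p⊆q∧y∈q⇒p∪⁅y⁆⊆q S⊆∁B (x∉p⇒x∈∁p e∉B) , ⊆-trans ∁B⊆S∪P p∪q⊆[p∪⁅x⁆]∪[q∖x]
  ... | yes e∈B = cobase-exchange-∈ baseB S⊆∁B ∁B⊆S∪P e∈B indS∪e

Nondecreasing : (Subset n → ℚ) → Set
Nondecreasing g = ∀ {A B} → A ⊆ B → g A ≤ g B

CurvatureAtMost⁺ : ℚ → (Subset n → ℚ) → Set
CurvatureAtMost⁺ c g = ∀ j A B → j ∉ A → j ∉ B → (1ℚ - c) * marg g B j ≤ marg g A j

module _ (f : Subset n → ℚ) where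

  dualFn-nondecreasing : Nonincreasing f → Nondecreasing (dualFn f)
  dualFn-nondecreasing f-antitone = f-antitone ∘ p⊆q⇒∁p⊇∁q

  dualFn-curvature : ∀ c → CurvatureAtMost c f → CurvatureAtMost⁺ c (dualFn f)
  dualFn-curvature c curv j A B j∉A j∉B = begin
    (1ℚ - c) * marg g B j                    ≡⟨ scale-negated-difference (1ℚ - c) (g (B ∪ ⁅ j ⁆)) (g B) ⟩
    - ((1ℚ - c) * (g B - g (B ∪ ⁅ j ⁆)))     ≤⟨ neg-antimono-≤ (begin
        g A - g (A ∪ ⁅ j ⁆)                  ≡⟨ marg-complement j∉A ⟨
        marg f (∁ (A ∪ ⁅ j ⁆)) j             ≤⟨ curv j _ _ (j∉∁[X∪j] A) (j∉∁[X∪j] B) ⟩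
        (1ℚ - c) * marg f (∁ (B ∪ ⁅ j ⁆)) j  ≡⟨ cong ((1ℚ - c) *_) (marg-complement j∉B) ⟩
        (1ℚ - c) * (g B - g (B ∪ ⁅ j ⁆))     ∎) ⟩
    - (g A - g (A ∪ ⁅ j ⁆))                  ≡⟨ negate-difference (g A) (g (A ∪ ⁅ j ⁆)) ⟩
    marg g A j                               ∎
    where
    open ≤-Reasoning
    g = dualFn f
    scale-negated-difference : ∀ a u v → a * (u - v) ≡ - (a * (v - u))
    scale-negated-difference = solve 3 (λ a u v → a :* (u :- v) := :- (a :* (v :- u))) refl
    negate-difference : ∀ u v → - (u - v) ≡ v - u
    negate-difference = solve 2 (λ u v → :- (u :- v) := v :- u) refl
    marg-complement : ∀ {X} → j ∉ X → marg f (∁ (X ∪ ⁅ j ⁆)) j ≡ g X - g (X ∪ ⁅ j ⁆)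
    marg-complement {X} j∉X = cong (λ Y → f Y - f (∁ (X ∪ ⁅ j ⁆))) (∁[p∪⁅x⁆]∪⁅x⁆≡∁p j∉X)
    j∉∁[X∪j] : ∀ X → j ∉ ∁ (X ∪ ⁅ j ⁆)
    j∉∁[X∪j] X = x∈p⇒x∉∁p (x∈p∪⁅x⁆ {p = X})

module _ (M : Matroid n) {g : Subset n → ℚ} {c : ℚ} (c≤1 : c ≤ 1ℚ)
         (g-nondecreasing : Nondecreasing g) (g-curvature : CurvatureAtMost⁺ c g) where

  greedy-bound : ∀ {S T P} → GreedyRun (DualIndep M) g S T → CobaseBetween M S (S ∪ P) →
                 (1ℚ - c) * (g T - g S) ≤ g P - g ⊥
  greedy-bound {S} {P = P} (stop _) _ = begin
    (1ℚ - c) * (g S - g S) ≡⟨ solve 2 (λ a u → a :* (u :- u) := con 0ℚ) refl (1ℚ - c) (g S) ⟩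
    0ℚ                     ≤⟨ p≤q⇒0≤q-p (g-nondecreasing ⊥⊆) ⟩
    g P - g ⊥              ∎
    where open ≤-Reasoning
  greedy-bound {S} {T} {P} (step e e∉S indS∪e e-minimizes run) cobase
    with cobase-exchange M cobase e∉S indS∪e
  ... | o , o∈P , o∉S , indS∪o , cobase′ = begin
    a * (g T - g S)                            ≡⟨ split (g T) (g (S ∪ ⁅ e ⁆)) (g S) ⟩
    a * (g T - g (S ∪ ⁅ e ⁆)) + a * marg g S e ≤⟨ +-mono-≤ (greedy-bound run cobase′)
                                                    (*-monoˡ-≤-nonNeg a (e-minimizes o o∉S indS∪o)) ⟩
    (g (P ∖ o) - g ⊥) + a * marg g S o         ≤⟨ +-monoʳ-≤ (g (P ∖ o) - g ⊥)
                                                    (g-curvature o (P ∖ o) S x∉p∖x o∉S) ⟩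
    (g (P ∖ o) - g ⊥) + marg g (P ∖ o) o       ≡⟨ telescope (g ⊥) (g (P ∖ o)) (g ((P ∖ o) ∪ ⁅ o ⁆)) ⟩
    g ((P ∖ o) ∪ ⁅ o ⁆) - g ⊥                  ≡⟨ cong (λ X → g X - g ⊥) (p∖x∪⁅x⁆≡p o∈P) ⟩
    g P - g ⊥                                  ∎
    where
    open ≤-Reasoning
    a = 1ℚ - c
    instance _ = nonNegative (p≤q⇒0≤q-p c≤1)
    split : ∀ u v w → a * (u - w) ≡ a * (u - v) + a * (v - w)
    split = solve 4 (λ a u v w → a :* (u :- w) := a :* (u :- v) :+ a :* (v :- w)) refl a
    telescope : ∀ u v w → (v - u) + (w - v) ≡ w - u
    telescope = solve 3 (λ u v w → (v :- u) :+ (w :- v) := w :- u) refl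

corollary15 : ∀ {n : ℕ} (f : Subset n → ℚ) (c : ℚ) (M : Matroid n) →
    (∀ A → 0ℚ ≤ f A) → Nonincreasing f →
    0ℚ ≤ c → c ≤ 1ℚ → CurvatureAtMost c f →
    (S* : Subset n) → GreedyOutput (DualIndep M) (dualFn f) S* →
    (O : Subset n) → IsBase M O →
    f (∁ S*) ≡ dualFn f S*
    × ((c<1 : c < 1ℚ) → dualFn f S* ≤ inv1-c c c<1 * dualFn f (∁ O))
    × dualFn f (∁ O) ≡ f O
corollary15 f c M f≥0 f-nonincreasing 0≤c c≤1 curvature S* greedy O baseO =
  refl , approximation , cong f (∁-involutive O)
  where
  bound : (1ℚ - c) * (dualFn f S* - dualFn f ⊥) ≤ dualFn f (∁ O) - dualFn f ⊥
  bound = greedy-bound M c≤1 (dualFn-nondecreasing f f-nonincreasing) (dualFn-curvature f c curvature)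
            greedy (O , baseO , ⊥⊆ , q⊆p∪q ⊥ (∁ O))
  approximation : (c<1 : c < 1ℚ) → dualFn f S* ≤ inv1-c c c<1 * dualFn f (∁ O)
  approximation c<1 = p*q≤r⇒q≤1/p*r (1-c-pos c<1) (p*[q-r]≤s-r⇒p*q≤s (0≤p⇒q-p≤q 0≤c) (f≥0 _) bound)
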